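{- Let $H$ be a maximal plane graph and $f$ a face of $H$. If $u$ and $v$ are vertices in $\mathrm{qcc}_H(H[f])$, then $|d(u,V(H[f]))-d(v,V(H[f]))|\leq 1$.
   Context: A maximal plane graph is a plane embedding of a maximal planar graph. $d$ is shortest-path distance in $H$, with $d(v,A)=\min_{a\in A}d(v,a)$. For a face $f$, $H[f]$ is the subgraph formed by the vertices and edges on the boundary of $f$. For $S\subseteq V(H)$, $\mathrm{qcc}_H(S)=\{u\in V(H): \forall v\in V(H)\ \exists s\in S \text{ with } d_H(u,s)\geq d_H(v,s)\}$. -}

module Defs where

open import Data.Nat using (ℕ; zero; suc; _+_; _*_; _≤_; _≤ᵇ_)
open import Data.Bool using (Bool; true; false; _∧_; _∨_; not; if_then_else_)
open import Data.Fin using (Fin; toℕ)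
open import Data.Fin.Properties using (_≟_)
open import Data.List using (List; []; _∷_; upTo; allFin; length; filter; concatMap; map)
open import Data.Product using (Σ; _×_; _,_; proj₁; ∃)
open import Data.Sum using (_⊎_)
open import Relation.Nullary using (¬_; does)
open import Relation.Binary.PropositionalEquality using (_≡_; _≢_)

Adj : ℕ → Set
Adj n = Fin n → Fin n → Bool

SimpleGraph : ∀ {n} → Adj n → Set
SimpleGraph {n} adj = (∀ x y → adj x y ≡ adj y x) × (∀ x → adj x x ≡ false)

data Walk {n} (adj : Adj n) : Fin n → Fin n → ℕ → Set where
  nil  : ∀ {u} → Walk adj u u 0
  cons : ∀ {u w v k} → adj u w ≡ true → Walk adj w v k → Walk adj u v (suc k)

Connected : ∀ {n} → Adj n → Set
Connected {n} adj = ∀ (u v : Fin n) → ∃ λ k → Walk adj u v k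

IsDist : ∀ {n} → Adj n → Fin n → Fin n → ℕ → Set
IsDist adj u v k = Walk adj u v k × (∀ j → Walk adj u v j → k ≤ j)

IsDistSet : ∀ {n} → Adj n → Fin n → (Fin n → Set) → ℕ → Set
IsDistSet {n} adj u A k =
  (Σ (Fin n) λ a → A a × IsDist adj u a k) ×
  (∀ (a : Fin n) j → A a → IsDist adj u a j → k ≤ j)

InQcc : ∀ {n} → Adj n → (Fin n → Set) → Fin n → Set
InQcc {n} adj S u =
  ∀ (v : Fin n) → Σ (Fin n) λ s → S s ×
    Σ ℕ λ a → Σ ℕ λ b → IsDist adj u s a × IsDist adj v s b × b ≤ a

-- Rotation systems: ρ x is the cyclic successor on the neighbourhood of x.
Rot : ℕ → Set
Rot n = Fin n → Fin n → Fin n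

iter : ∀ {A : Set} → (A → A) → ℕ → A → A
iter f zero a = a
iter f (suc k) a = f (iter f k a)

IsRotation : ∀ {n} → Adj n → Rot n → Set
IsRotation {n} adj ρ =
  (∀ x y → adj x y ≡ true → adj x (ρ x y) ≡ true) ×
  (∀ x y z → adj x y ≡ true → adj x z ≡ true → ∃ λ k → iter (ρ x) k y ≡ z)

Dart : ℕ → Set
Dart n = Fin n × Fin n

-- face permutation: (x,y) ↦ (y, ρ y x)
φ : ∀ {n} → Rot n → Dart n → Dart n
φ ρ (x , y) = (y , ρ y x)

allDarts : ∀ {n} → Adj n → List (Dart n)
allDarts {n} adj =
  filter (λ d → adj (proj₁ d) (Data.Product.proj₂ d) Data.Bool.≟ true)
    (concatMap (λ x → map (λ y → (x , y)) (allFin n)) (allFin n))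

code : ∀ {n} → Dart n → ℕ
code {n} (x , y) = toℕ x * n + toℕ y

allB : ∀ {A : Set} → (A → Bool) → List A → Bool
allB p [] = true
allB p (a ∷ as) = p a ∧ allB p as

-- a dart is the representative of its face if it has the least code in its φ-orbit
-- (orbits have size ≤ n*n, so the iterates below cover the whole orbit)
isRep : ∀ {n} → Rot n → Dart n → Bool
isRep {n} ρ d = allB (λ k → code d ≤ᵇ code (iter (φ ρ) k d)) (upTo (n * n))

numFaces : ∀ {n} → Adj n → Rot n → ℕ
numFaces adj ρ = length (filter (λ d → isRep ρ d Data.Bool.≟ true) (allDarts adj))

-- Euler's formula V - E + F = 2 (2E = number of darts); the one-vertex graph
-- (no darts, one face) is handled separately.
Genus0 : ∀ {n} → Adj n → Rot n → Set
Genus0 {n} adj ρ = (2 * n + 2 * numFaces adj ρ ≡ 4 + length (allDarts adj)) ⊎ (n ≡ 1)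

PlaneEmbedding : ∀ {n} → Adj n → Rot n → Set
PlaneEmbedding adj ρ = IsRotation adj ρ × Genus0 adj ρ

ConnectedPlanar : ∀ {n} → Adj n → Set
ConnectedPlanar {n} adj = Connected adj × Σ (Rot n) λ ρ → PlaneEmbedding adj ρ

addEdge : ∀ {n} → Adj n → Fin n → Fin n → Adj n
addEdge adj u v x y =
  adj x y ∨ (does (x ≟ u) ∧ does (y ≟ v)) ∨ (does (x ≟ v) ∧ does (y ≟ u))

MaximalPlanar : ∀ {n} → Adj n → Set
MaximalPlanar {n} adj =
  SimpleGraph adj × ConnectedPlanar adj ×
  (∀ (u v : Fin n) → u ≢ v → adj u v ≡ false → ¬ ConnectedPlanar (addEdge adj u v))

-- V(H[f]) for the face f traced by the dart d
FaceVertices : ∀ {n} → Rot n → Dart n → Fin n → Set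
FaceVertices ρ d w = ∃ λ k → proj₁ (iter (φ ρ) k d) ≡ w

{-# OPTIONS --safe #-}
-- Every face of a maximal plane graph is a clique. Otherwise two non-adjacent vertices a, b lie on
-- the boundary walk of one face, and drawing the chord ab through that face (inserting b into the
-- rotation at a, and a into the rotation at b, at the corners of the face) splits the face in two
-- while adding a single edge; Euler's formula V − E + F = 2 survives, so the enlarged graph is still
-- planar, contradicting maximality. For a clique F and any s ∈ F, d(v, s) ≤ d(v, F) + 1. Applying
-- the definition of v ∈ qcc(F) to u gives s ∈ F with d(u, s) ≤ d(v, s), hence
-- d(u, F) ≤ d(u, s) ≤ d(v, s) ≤ d(v, F) + 1, and symmetrically with u and v exchanged.

module Submission where

open import Defs
open import Data.Nat using (ℕ; zero; suc; pred; _≤_; _<_; _+_; _*_; _∸_; z≤n; s≤s; _≤ᵇ_; _≤?_; NonZero; >-nonZero)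
open import Data.Nat.Properties hiding (_≟_)
open import Data.Nat.DivMod using (_%_; _/_; m≡m%n+[m/n]*n; m%n<n)
open import Data.Nat.Induction using (<-wellFounded)
open import Data.Nat.Tactic.RingSolver using (solve-∀)
open import Data.Fin using (Fin; toℕ; combine)
open import Data.Fin.Properties using (_≟_; pigeonhole; toℕ<n; toℕ-injective; toℕ-combine; combine-injective)
open import Data.Bool using (Bool; true; false; _∧_; _∨_; not)
import Data.Bool
open import Data.Bool.Properties using (T-≡; not-¬; ∧-zeroʳ; ∨-identityʳ; ⇔→≡)
open import Data.List using (List; []; _∷_; _++_; map; concatMap; filter; length; applyUpTo; upTo; allFin; cartesianProduct)
open import Data.List.Membership.Propositional using (_∈_; _∉_)
open import Data.List.Membership.Propositional.Properties using (∈-cartesianProduct⁺; ∈-allFin)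
open import Data.List.Relation.Unary.Any using (here; there)
open import Data.List.Relation.Unary.All.Properties using (All¬⇒¬Any)
open import Data.List.Relation.Unary.AllPairs using (_∷_)
open import Data.List.Relation.Unary.Unique.Propositional using (Unique)
open import Data.List.Relation.Unary.Unique.Propositional.Properties using (cartesianProduct⁺; allFin⁺)
open import Data.Product using (_×_; _,_; proj₁; proj₂; ∃)
import Data.Product.Properties as Product
open import Data.Sum using (_⊎_; inj₁; inj₂; [_,_]; map₂)
open import Data.Empty using (⊥-elim)
open import Function using (_∘_; _⇔_; mk⇔; Equivalence)
open import Induction.WellFounded using (Acc; acc)
open import Relation.Nullary using (¬_; Dec; yes; no; does; _×-dec_)
open import Relation.Nullary.Decidable using (dec-true; dec-false)
open import Relation.Binary.Definitions using (DecidableEquality; tri<; tri≈; tri>)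
open import Relation.Binary.PropositionalEquality hiding ([_])

does≡true⇒ : ∀ {P : Set} (P? : Dec P) → does P? ≡ true → P
does≡true⇒ (yes p) _ = p

∨-true⁻ : ∀ x {y} → x ∨ y ≡ true → x ≡ true ⊎ y ≡ true
∨-true⁻ true  _  = inj₁ refl
∨-true⁻ false xy = inj₂ xy

∧-true⁻ : ∀ x {y} → x ∧ y ≡ true → x ≡ true × y ≡ true
∧-true⁻ true y = refl , y

∧-true⁺ : ∀ {x y} → x ≡ true → y ≡ true → x ∧ y ≡ true
∧-true⁺ refl refl = refl

∧-cong-true : ∀ x {y y'} → (x ≡ true → y ≡ y') → x ∧ y ≡ x ∧ y'
∧-cong-true true  y≡y' = y≡y' refl
∧-cong-true false _    = refl

∨-true⁺ˡ : ∀ {x} y → x ≡ true → x ∨ y ≡ true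
∨-true⁺ˡ y refl = refl

∨-true⁺ʳ : ∀ x {y} → y ≡ true → x ∨ y ≡ true
∨-true⁺ʳ true  _    = refl
∨-true⁺ʳ false refl = refl

iter-+ : ∀ {A : Set} (f : A → A) m n x → iter f (m + n) x ≡ iter f m (iter f n x)
iter-+ f zero    n x = refl
iter-+ f (suc m) n x = cong f (iter-+ f m n x)

iter-suc : ∀ {A : Set} (f : A → A) k x → iter f (suc k) x ≡ iter f k (f x)
iter-suc f k x = trans (cong (λ m → iter f m x) (+-comm 1 k)) (iter-+ f k 1 x)

iter-cong : ∀ {A : Set} {f g : A → A} → (∀ y → f y ≡ g y) → ∀ k x → iter f k x ≡ iter g k x
iter-cong f≗g zero    x = refl
iter-cong {g = g} f≗g (suc k) x = trans (f≗g _) (cong g (iter-cong f≗g k x))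

module _ {A : Set} (f : A → A) {P : ℕ} {x : A} (period : iter f P x ≡ x) where

  iter-periodic-* : ∀ q → iter f (q * P) x ≡ x
  iter-periodic-* zero    = refl
  iter-periodic-* (suc q) = begin
    iter f (P + q * P) x      ≡⟨ iter-+ f P (q * P) x ⟩
    iter f P (iter f (q * P) x) ≡⟨ cong (iter f P) (iter-periodic-* q) ⟩
    iter f P x                ≡⟨ period ⟩
    x                         ∎
    where open ≡-Reasoning

  iter-periodic-iter : ∀ i → iter f P (iter f i x) ≡ iter f i x
  iter-periodic-iter i = begin
    iter f P (iter f i x) ≡⟨ iter-+ f P i x ⟨
    iter f (P + i) x      ≡⟨ cong (λ m → iter f m x) (+-comm P i) ⟩
    iter f (i + P) x      ≡⟨ iter-+ f i P x ⟩
    iter f i (iter f P x) ≡⟨ cong (iter f i) period ⟩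
    iter f i x            ∎
    where open ≡-Reasoning

  iter-periodic-reach : .{{_ : NonZero P}} → ∀ i j → iter f (j + i * P ∸ i) (iter f i x) ≡ iter f j x
  iter-periodic-reach i j = begin
    iter f (j + i * P ∸ i) (iter f i x)   ≡⟨ iter-+ f (j + i * P ∸ i) i x ⟨
    iter f (j + i * P ∸ i + i) x          ≡⟨ cong (λ m → iter f m x) (m∸n+n≡m i≤j+iP) ⟩
    iter f (j + i * P) x                  ≡⟨ iter-+ f j (i * P) x ⟩
    iter f j (iter f (i * P) x)           ≡⟨ cong (iter f j) (iter-periodic-* i) ⟩
    iter f j x                            ∎
    where open ≡-Reasoning
          i≤j+iP : i ≤ j + i * P
          i≤j+iP = ≤-trans (m≤m*n i P) (m≤n+m (i * P) j)

  iter-periodic-% : .{{_ : NonZero P}} → ∀ k → iter f k x ≡ iter f (k % P) x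
  iter-periodic-% k = begin
    iter f k x                                ≡⟨ cong (λ m → iter f m x) (m≡m%n+[m/n]*n k P) ⟩
    iter f (k % P + k / P * P) x              ≡⟨ iter-+ f (k % P) (k / P * P) x ⟩
    iter f (k % P) (iter f (k / P * P) x)     ≡⟨ cong (iter f (k % P)) (iter-periodic-* (k / P)) ⟩
    iter f (k % P) x                          ∎
    where open ≡-Reasoning

boolToℕ : Bool → ℕ
boolToℕ true  = 1
boolToℕ false = 0

count : ∀ {A : Set} → (A → Bool) → List A → ℕ
count p []       = 0
count p (x ∷ xs) = boolToℕ (p x) + count p xs

module _ {A : Set} where

  count-filter : ∀ (p q : A → Bool) xs →
    count q (filter (λ x → p x Data.Bool.≟ true) xs) ≡ count (λ x → p x ∧ q x) xs
  count-filter p q []       = refl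
  count-filter p q (x ∷ xs) with p x
  ... | true  = cong (boolToℕ (q x) +_) (count-filter p q xs)
  ... | false = count-filter p q xs

  length-filter : ∀ (p : A → Bool) xs → length (filter (λ x → p x Data.Bool.≟ true) xs) ≡ count p xs
  length-filter p []       = refl
  length-filter p (x ∷ xs) with p x
  ... | true  = cong suc (length-filter p xs)
  ... | false = length-filter p xs

  count-cong : ∀ {p q : A → Bool} → (∀ x → p x ≡ q x) → ∀ xs → count p xs ≡ count q xs
  count-cong p≗q []       = refl
  count-cong p≗q (x ∷ xs) = cong₂ _+_ (cong boolToℕ (p≗q x)) (count-cong p≗q xs)

  count-∨ : ∀ (p q : A → Bool) → (∀ x → p x ∧ q x ≡ false) → ∀ xs →
    count (λ x → p x ∨ q x) xs ≡ count p xs + count q xs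
  count-∨ p q disjoint []       = refl
  count-∨ p q disjoint (x ∷ xs) with p x | q x | disjoint x
  ... | true  | true  | ()
  ... | true  | false | _ = cong suc (count-∨ p q disjoint xs)
  ... | false | true  | _ = trans (cong suc (count-∨ p q disjoint xs)) (sym (+-suc (count p xs) (count q xs)))
  ... | false | false | _ = count-∨ p q disjoint xs

  count-split : ∀ (p s : A → Bool) xs →
    count p xs ≡ count (λ x → p x ∧ not (s x)) xs + count (λ x → p x ∧ s x) xs
  count-split p s []       = refl
  count-split p s (x ∷ xs) with p x | s x
  ... | true  | true  = trans (cong suc (count-split p s xs)) (sym (+-suc _ _))
  ... | true  | false = cong suc (count-split p s xs)
  ... | false | _     = count-split p s xs

  module _ (_≟_ : DecidableEquality A) where

    count-≟-∉ : ∀ {e xs} → e ∉ xs → count (λ x → does (x ≟ e)) xs ≡ 0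
    count-≟-∉ {e} {[]}     e∉ = refl
    count-≟-∉ {e} {x ∷ xs} e∉
      rewrite dec-false (x ≟ e) (λ x≡e → e∉ (here (sym x≡e))) = count-≟-∉ (e∉ ∘ there)

    count-≟-unique : ∀ {e xs} → Unique xs → e ∈ xs → count (λ x → does (x ≟ e)) xs ≡ 1
    count-≟-unique {e} {x ∷ xs} (x∉xs ∷ _) (here refl)
      rewrite dec-true (x ≟ x) refl = cong suc (count-≟-∉ (All¬⇒¬Any x∉xs))
    count-≟-unique {e} {x ∷ xs} (x∉xs ∷ unique) (there e∈xs)
      rewrite dec-false (x ≟ e) (λ { refl → All¬⇒¬Any x∉xs e∈xs })
      = count-≟-unique unique e∈xs

argmin : (g : ℕ → ℕ) (r : ℕ) → ∃ λ i → i ≤ r × ∀ j → j ≤ r → g i ≤ g j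
argmin g zero    = 0 , z≤n , λ { zero z≤n → ≤-refl }
argmin g (suc r) with argmin g r
... | i , i≤r , min with g i ≤? g (suc r)
...   | yes gᵢ≤ = i , m≤n⇒m≤1+n i≤r , λ j j≤ →
        [ min j ∘ ≤-pred , (λ { refl → gᵢ≤ }) ] (m≤n⇒m<n∨m≡n j≤)
...   | no  gᵢ≰ = suc r , ≤-refl , λ j j≤ →
        [ ≤-trans (<⇒≤ (≰⇒> gᵢ≰)) ∘ min j ∘ ≤-pred , (λ { refl → ≤-refl }) ] (m≤n⇒m<n∨m≡n j≤)

module Orbits {A : Set} (f : A → A) (D : A → Set)
  (f-closed : ∀ {x} → D x → D (f x))
  (f-injective : ∀ {x y} → D x → D y → f x ≡ f y → x ≡ y) where

  iter-closed : ∀ k {x} → D x → D (iter f k x)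
  iter-closed zero    Dx = Dx
  iter-closed (suc k) Dx = f-closed (iter-closed k Dx)

  iter-injective : ∀ k {x y} → D x → D y → iter f k x ≡ iter f k y → x ≡ y
  iter-injective zero    Dx Dy eq = eq
  iter-injective (suc k) Dx Dy eq =
    iter-injective k Dx Dy (f-injective (iter-closed k Dx) (iter-closed k Dy) eq)

  record Cycle (x : A) (P : ℕ) : Set where
    field
      nonempty : 1 ≤ P
      closes   : iter f P x ≡ x
      minimal  : ∀ k → 1 ≤ k → k < P → iter f k x ≢ x

  no-early-return : ∀ {x P} → Cycle x P → ∀ {i j} → i < j → j < P → iter f (j ∸ i) x ≢ x
  no-early-return c {i} {j} i<j j<P = Cycle.minimal c (j ∸ i) (m<n⇒0<n∸m i<j) (≤-<-trans (m∸n≤m j i) j<P)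

  module _ {x} (Dx : D x) where

    repeat⇒return : ∀ {i j} → i ≤ j → iter f i x ≡ iter f j x → iter f (j ∸ i) x ≡ x
    repeat⇒return {i} {j} i≤j eq = sym (iter-injective i Dx (iter-closed (j ∸ i) Dx) (begin
      iter f i x               ≡⟨ eq ⟩
      iter f j x               ≡⟨ cong (λ m → iter f m x) (m+[n∸m]≡n i≤j) ⟨
      iter f (i + (j ∸ i)) x   ≡⟨ iter-+ f i (j ∸ i) x ⟩
      iter f i (iter f (j ∸ i) x) ∎))
      where open ≡-Reasoning

    cycle-injective : ∀ {P} → Cycle x P → ∀ {i j} → i < P → j < P → iter f i x ≡ iter f j x → i ≡ j
    cycle-injective c {i} {j} i<P j<P eq with <-cmp i j
    ... | tri≈ _ i≡j _ = i≡j
    ... | tri< i<j _ _ = ⊥-elim (no-early-return c i<j j<P (repeat⇒return (<⇒≤ i<j) eq))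
    ... | tri> _ _ j<i = ⊥-elim (no-early-return c j<i i<P (repeat⇒return (<⇒≤ j<i) (sym eq)))

  module Finite (_≟_ : DecidableEquality A) {N : ℕ} (encode : A → Fin N)
    (encode-injective : ∀ {x y} → encode x ≡ encode y → x ≡ y) where

    return-within : ∀ {x} → D x → ∃ λ t → 1 ≤ t × t ≤ N × iter f t x ≡ x
    return-within {x} Dx with pigeonhole (n<1+n N) (λ i → encode (iter f (toℕ i) x))
    ... | i , j , i<j , eq =
      toℕ j ∸ toℕ i , m<n⇒0<n∸m i<j , ≤-trans (m∸n≤m (toℕ j) (toℕ i)) (≤-pred (toℕ<n j)) ,
      repeat⇒return Dx (<⇒≤ i<j) (encode-injective eq)

    first-return : ∀ {x} t → Acc _<_ t → 1 ≤ t → iter f t x ≡ x → ∃ λ P → P ≤ t × Cycle x P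
    first-return {x} t (acc smaller) 1≤t ret with anyUpTo? (λ k → (1 ≤? k) ×-dec (iter f k x ≟ x)) t
    ... | yes (k , k<t , 1≤k , retₖ) with first-return k (smaller k<t) 1≤k retₖ
    ...   | P , P≤k , c = P , ≤-trans P≤k (<⇒≤ k<t) , c
    first-return {x} t _ 1≤t ret | no none =
      t , ≤-refl , record
        { nonempty = 1≤t
        ; closes   = ret
        ; minimal  = λ k 1≤k k<t retₖ → none (k , k<t , 1≤k , retₖ)
        }

    cycle-through : ∀ {x} → D x → ∃ λ P → P ≤ N × Cycle x P
    cycle-through Dx with return-within Dx
    ... | t , 1≤t , t≤N , ret with first-return t (<-wellFounded t) 1≤t ret
    ...   | P , P≤t , c = P , ≤-trans P≤t t≤N , c

allB-applyUpTo⁻ : ∀ (p : ℕ → Bool) (g : ℕ → ℕ) N →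
  allB p (applyUpTo g N) ≡ true → ∀ k → k < N → p (g k) ≡ true
allB-applyUpTo⁻ p g (suc N) all k k<N with p (g 0) in p₀
allB-applyUpTo⁻ p g (suc N) all zero    _         | true = p₀
allB-applyUpTo⁻ p g (suc N) all (suc k) (s≤s k<N) | true = allB-applyUpTo⁻ p (g ∘ suc) N all k k<N

allB-applyUpTo⁺ : ∀ (p : ℕ → Bool) (g : ℕ → ℕ) N →
  (∀ k → k < N → p (g k) ≡ true) → allB p (applyUpTo g N) ≡ true
allB-applyUpTo⁺ p g zero    all = refl
allB-applyUpTo⁺ p g (suc N) all rewrite all 0 (s≤s z≤n) =
  allB-applyUpTo⁺ p (g ∘ suc) N (λ k k<N → all (suc k) (s≤s k<N))

module _ {n : ℕ} where

  _≟ᴰ_ : DecidableEquality (Dart n)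
  _≟ᴰ_ = Product.≡-dec _≟_ _≟_

  encodeDart : Dart n → Fin (n * n)
  encodeDart (x , y) = combine x y

  encodeDart-injective : ∀ {d e} → encodeDart d ≡ encodeDart e → d ≡ e
  encodeDart-injective {x , y} {x' , y'} eq with combine-injective x y x' y' eq
  ... | refl , refl = refl

  code≡toℕ∘encodeDart : ∀ d → code d ≡ toℕ (encodeDart d)
  code≡toℕ∘encodeDart (x , y) = trans (cong (_+ toℕ y) (*-comm (toℕ x) n)) (sym (toℕ-combine x y))

  code-injective : ∀ {d e} → code d ≡ code e → d ≡ e
  code-injective {d} {e} eq = encodeDart-injective (toℕ-injective
    (trans (sym (code≡toℕ∘encodeDart d)) (trans eq (code≡toℕ∘encodeDart e))))

  allPairs : List (Dart n)
  allPairs = concatMap (λ x → map (x ,_) (allFin n)) (allFin n)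

  allPairs≡cartesianProduct : allPairs ≡ cartesianProduct (allFin n) (allFin n)
  allPairs≡cartesianProduct = go (allFin n)
    where
    go : ∀ xs → concatMap (λ x → map (x ,_) (allFin n)) xs ≡ cartesianProduct xs (allFin n)
    go []       = refl
    go (x ∷ xs) = cong (map (x ,_) (allFin n) ++_) (go xs)

  count-≟ᴰ : ∀ e → count (λ d → does (d ≟ᴰ e)) allPairs ≡ 1
  count-≟ᴰ (x , y) rewrite allPairs≡cartesianProduct =
    count-≟-unique _≟ᴰ_ (cartesianProduct⁺ (allFin⁺ n) (allFin⁺ n))
                        (∈-cartesianProduct⁺ (∈-allFin x) (∈-allFin y))

  count-≟ᴰ-pair : ∀ {e e'} → e ≢ e' → count (λ d → does (d ≟ᴰ e) ∨ does (d ≟ᴰ e')) allPairs ≡ 2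
  count-≟ᴰ-pair {e} {e'} e≢e' =
    trans (count-∨ _ _ disjoint allPairs) (cong₂ _+_ (count-≟ᴰ e) (count-≟ᴰ e'))
    where
    disjoint : ∀ d → does (d ≟ᴰ e) ∧ does (d ≟ᴰ e') ≡ false
    disjoint d with d ≟ᴰ e
    ... | yes refl = dec-false (d ≟ᴰ e') e≢e'
    ... | no  _    = refl

  -- isRep ρ is definitionally isOrbitMin (φ ρ): a face is counted through the dart of least code
  -- on its orbit, and abstracting φ ρ lets the same lemmas serve the modified rotation system.
  isOrbitMin : (Dart n → Dart n) → Dart n → Bool
  isOrbitMin σ d = allB (λ k → code d ≤ᵇ code (iter σ k d)) (upTo (n * n))

  isOrbitMin-cong : ∀ {σ σ' d} → (∀ k → iter σ k d ≡ iter σ' k d) → isOrbitMin σ d ≡ isOrbitMin σ' d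
  isOrbitMin-cong {σ} {σ'} {d} same = allB-cong (upTo (n * n))
    where
    allB-cong : ∀ ks → allB (λ k → code d ≤ᵇ code (iter σ k d)) ks
                     ≡ allB (λ k → code d ≤ᵇ code (iter σ' k d)) ks
    allB-cong []       = refl
    allB-cong (k ∷ ks) = cong₂ _∧_ (cong (λ e → code d ≤ᵇ code e) (same k)) (allB-cong ks)

  module OrbitMin (σ : Dart n → Dart n) (o : Dart n) (P : ℕ) .{{_ : NonZero P}}
    (P≤ : P ≤ n * n) (closes : iter σ P o ≡ o) where

    it : ℕ → Dart n
    it i = iter σ i o

    reach : ∀ i j → ∃ λ k → k < P × iter σ k (it i) ≡ it j
    reach i j = k % P , m%n<n k P ,
      trans (sym (iter-periodic-% σ {P} (iter-periodic-iter σ {P} closes i) k)) (iter-periodic-reach σ {P} closes i j)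
      where k : ℕ
            k = j + i * P ∸ i

    isOrbitMin⇒≤ : ∀ i → isOrbitMin σ (it i) ≡ true → ∀ j → code (it i) ≤ code (it j)
    isOrbitMin⇒≤ i min j with reach i j
    ... | k , k<P , eq = subst (λ d → code (it i) ≤ code d) eq
      (≤ᵇ⇒≤ _ _ (Equivalence.from T-≡ (allB-applyUpTo⁻ _ (λ k → k) (n * n) min k (<-≤-trans k<P P≤))))

    ≤⇒isOrbitMin : ∀ i → (∀ j → code (it i) ≤ code (it j)) → isOrbitMin σ (it i) ≡ true
    ≤⇒isOrbitMin i min = allB-applyUpTo⁺ _ (λ k → k) (n * n) λ k _ →
      Equivalence.to T-≡ (≤⇒≤ᵇ (subst (λ d → code (it i) ≤ code d) (iter-+ σ k i o) (min (k + i))))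

    least : ∃ λ i₀ → i₀ < P × ∀ j → code (it i₀) ≤ code (it j)
    least with argmin (code ∘ it) (pred P)
    ... | i₀ , i₀≤ , min = i₀ , subst (i₀ <_) (suc-pred P) (s≤s i₀≤) , λ j →
      subst (λ d → code (it i₀) ≤ code d) (sym (iter-periodic-% σ {P} closes j))
            (min (j % P) (<⇒≤pred (m%n<n j P)))

    orbitMin : Dart n
    orbitMin = it (proj₁ least)

    isOrbitMin-orbitMin : isOrbitMin σ orbitMin ≡ true
    isOrbitMin-orbitMin = ≤⇒isOrbitMin (proj₁ least) (proj₂ (proj₂ least))

    isOrbitMin⇒≡orbitMin : ∀ i → isOrbitMin σ (it i) ≡ true → it i ≡ orbitMin
    isOrbitMin⇒≡orbitMin i min =
      code-injective (≤-antisym (isOrbitMin⇒≤ i min (proj₁ least)) (proj₂ (proj₂ least) i))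

  does-≟ᴰ : ∀ x y u v → does ((x , y) ≟ᴰ (u , v)) ≡ does (x ≟ u) ∧ does (y ≟ v)
  does-≟ᴰ x y u v = by-cases (x ≟ u) (y ≟ v)
    where
    by-cases : (x≟u : Dec (x ≡ u)) (y≟v : Dec (y ≡ v)) → does ((x , y) ≟ᴰ (u , v)) ≡ does x≟u ∧ does y≟v
    by-cases (yes refl) (yes refl) = dec-true ((x , y) ≟ᴰ (u , v)) refl
    by-cases (yes _)    (no  y≢v)  = dec-false ((x , y) ≟ᴰ (u , v)) (y≢v ∘ cong proj₂)
    by-cases (no  x≢u)  _          = dec-false ((x , y) ≟ᴰ (u , v)) (x≢u ∘ cong proj₁)

record IsCyclicOn {A : Set} (S : A → Set) (g : A → A) : Set where
  field
    closed : ∀ {y} → S y → S (g y)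
    cyclic : ∀ {y z} → S y → S z → ∃ λ k → iter g k y ≡ z

module _ {n : ℕ} {adj : Adj n} {ρ : Rot n} where

  rotation-at : IsRotation adj ρ → ∀ x → IsCyclicOn (λ y → adj x y ≡ true) (ρ x)
  rotation-at (closed , cyclic) x = record { closed = closed x _ ; cyclic = cyclic x _ _ }

  rotation-from : (∀ x → IsCyclicOn (λ y → adj x y ≡ true) (ρ x)) → IsRotation adj ρ
  rotation-from cyc = (λ x y → IsCyclicOn.closed (cyc x)) , (λ x y z → IsCyclicOn.cyclic (cyc x))

module _ {A : Set} {S S' : A → Set} {g : A → A} where

  IsCyclicOn-⇔ : (∀ y → S y ⇔ S' y) → IsCyclicOn S g → IsCyclicOn S' g
  IsCyclicOn-⇔ S⇔S' cyc = record
    { closed = to ∘ closed ∘ from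
    ; cyclic = λ Sy Sz → cyclic (from Sy) (from Sz)
    }
    where
    open IsCyclicOn cyc
    to : ∀ {y} → S y → S' y
    to {y} = Equivalence.to (S⇔S' y)
    from : ∀ {y} → S' y → S y
    from {y} = Equivalence.from (S⇔S' y)

IsCyclicOn-cong : ∀ {A : Set} {S : A → Set} {g g' : A → A} →
  (∀ y → g y ≡ g' y) → IsCyclicOn S g → IsCyclicOn S g'
IsCyclicOn-cong {S = S} g≗g' cyc = record
  { closed = λ {y} Sy → subst S (g≗g' y) (closed Sy)
  ; cyclic = λ {y} Sy Sz → let (k , eq) = cyclic Sy Sz in k , trans (sym (iter-cong g≗g' k y)) eq
  }
  where open IsCyclicOn cyc

module Insertion {A : Set} (_≟_ : DecidableEquality A) where

  insertAfter : (A → A) → A → A → A → A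
  insertAfter g p c y with y ≟ p | y ≟ c
  ... | yes _ | _     = c
  ... | no  _ | yes _ = g p
  ... | no  _ | no  _ = g y

  module _ (g : A → A) (p c : A) where

    insertAfter-p : insertAfter g p c p ≡ c
    insertAfter-p with p ≟ p
    ... | yes _   = refl
    ... | no  p≢p = ⊥-elim (p≢p refl)

    insertAfter-c : c ≢ p → insertAfter g p c c ≡ g p
    insertAfter-c c≢p with c ≟ p | c ≟ c
    ... | yes c≡p | _       = ⊥-elim (c≢p c≡p)
    ... | no  _   | yes _   = refl
    ... | no  _   | no  c≢c = ⊥-elim (c≢c refl)

    insertAfter-other : ∀ {y} → y ≢ p → y ≢ c → insertAfter g p c y ≡ g y
    insertAfter-other {y} y≢p y≢c with y ≟ p | y ≟ c
    ... | yes y≡p | _       = ⊥-elim (y≢p y≡p)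
    ... | no  _   | yes y≡c = ⊥-elim (y≢c y≡c)
    ... | no  _   | no  _   = refl

  module _ {S : A → Set} {g : A → A} (cyc : IsCyclicOn S g) {p c : A} (Sp : S p) (¬Sc : ¬ S c) where

    open IsCyclicOn cyc

    private
      h : A → A
      h = insertAfter g p c

      S⇒≢c : ∀ {y} → S y → y ≢ c
      S⇒≢c Sy refl = ¬Sc Sy

      h-p : h p ≡ c
      h-p = insertAfter-p g p c

      h-c : h c ≡ g p
      h-c = insertAfter-c g p c (S⇒≢c Sp ∘ sym)

      simulate : ∀ {y} → S y → ∀ k → ∃ λ k' → iter h k' y ≡ iter g k y
      simulate Sy zero = 0 , refl
      simulate {y} Sy (suc k) with simulate Sy k | iter g k y ≟ p
      ... | k' , eq | yes ≡p = suc (suc k') , (begin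
        h (h (iter h k' y)) ≡⟨ cong (h ∘ h) (trans eq ≡p) ⟩
        h (h p)             ≡⟨ cong h h-p ⟩
        h c                 ≡⟨ h-c ⟩
        g p                 ≡⟨ cong g ≡p ⟨
        g (iter g k y)      ∎)
        where open ≡-Reasoning
      ... | k' , eq | no ≢p = suc k' , trans (cong h eq) (insertAfter-other g p c ≢p (S⇒≢c (iter-S k)))
        where iter-S : ∀ k → S (iter g k y)
              iter-S zero    = Sy
              iter-S (suc k) = closed (iter-S k)

      from-S : ∀ {y z} → S y → S z ⊎ z ≡ c → ∃ λ k → iter h k y ≡ z
      from-S Sy (inj₁ Sz) with cyclic Sy Sz
      ... | k , eq with simulate Sy k
      ...   | k' , eq' = k' , trans eq' eq
      from-S Sy (inj₂ refl) with cyclic Sy Sp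
      ... | k , eq with simulate Sy k
      ...   | k' , eq' = suc k' , trans (cong h (trans eq' eq)) h-p

    insertAfter-isCyclicOn : IsCyclicOn (λ y → S y ⊎ y ≡ c) (insertAfter g p c)
    insertAfter-isCyclicOn = record { closed = closed' ; cyclic = cyclic' }
      where
      closed' : ∀ {y} → S y ⊎ y ≡ c → S (h y) ⊎ h y ≡ c
      closed' {y} (inj₁ Sy) = by-cases (y ≟ p)
        where by-cases : Dec (y ≡ p) → S (h y) ⊎ h y ≡ c
              by-cases (yes y≡p) = inj₂ (trans (cong h y≡p) h-p)
              by-cases (no  y≢p) = inj₁ (subst S (sym (insertAfter-other g p c y≢p (S⇒≢c Sy))) (closed Sy))
      closed' (inj₂ refl) = inj₁ (subst S (sym h-c) (closed Sp))
      cyclic' : ∀ {y z} → S y ⊎ y ≡ c → S z ⊎ z ≡ c → ∃ λ k → iter h k y ≡ z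
      cyclic' (inj₁ Sy)   Sz = from-S Sy Sz
      cyclic' {y} {z} (inj₂ refl) Sz with from-S (closed Sp) Sz
      ... | k , eq = suc k , trans (iter-suc h k c) (trans (cong (iter h k) h-c) eq)

isDart : ∀ {n} → Adj n → Dart n → Bool
isDart adj d = adj (proj₁ d) (proj₂ d)

IsDart : ∀ {n} → Adj n → Dart n → Set
IsDart adj d = isDart adj d ≡ true

length-allDarts : ∀ {n} (adj : Adj n) → length (allDarts adj) ≡ count (isDart adj) allPairs
length-allDarts adj = length-filter (isDart adj) allPairs

numFaces≡count : ∀ {n} (adj : Adj n) (ρ : Rot n) →
  numFaces adj ρ ≡ count (λ d → isDart adj d ∧ isOrbitMin (φ ρ) d) allPairs
numFaces≡count adj ρ = trans (length-filter (isOrbitMin (φ ρ)) (allDarts adj))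
                              (count-filter (isDart adj) (isOrbitMin (φ ρ)) allPairs)

Walk-mono : ∀ {n} {adj adj' : Adj n} → (∀ {x y} → adj x y ≡ true → adj' x y ≡ true) →
  ∀ {u v k} → Walk adj u v k → Walk adj' u v k
Walk-mono ⊆ nil          = nil
Walk-mono ⊆ (cons xy w) = cons (⊆ xy) (Walk-mono ⊆ w)

Genus0-step : ∀ {n} {adj adj' : Adj n} {ρ ρ' : Rot n} →
  numFaces adj' ρ' ≡ suc (numFaces adj ρ) → length (allDarts adj') ≡ 2 + length (allDarts adj) →
  Genus0 adj ρ → Genus0 adj' ρ'
Genus0-step                                   _     _     (inj₂ n≡1)  = inj₂ n≡1
Genus0-step {n} {adj} {adj'} {ρ} {ρ'} faces darts (inj₁ euler) = inj₁ (begin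
  2 * n + 2 * numFaces adj' ρ'            ≡⟨ cong (λ F → 2 * n + 2 * F) faces ⟩
  2 * n + 2 * suc (numFaces adj ρ)        ≡⟨ shift (2 * n) (numFaces adj ρ) ⟩
  2 + (2 * n + 2 * numFaces adj ρ)        ≡⟨ cong (2 +_) euler ⟩
  4 + (2 + length (allDarts adj))         ≡⟨ cong (4 +_) darts ⟨
  4 + length (allDarts adj')              ∎)
  where open ≡-Reasoning
        shift : ∀ m F → m + 2 * suc F ≡ 2 + (m + 2 * F)
        shift = solve-∀

module RotationSystem {n : ℕ} (adj : Adj n) (ρ : Rot n) (simple : SimpleGraph adj) (rot : IsRotation adj ρ) where

  ρ-injective : ∀ {x y y'} → adj x y ≡ true → adj x y' ≡ true → ρ x y ≡ ρ x y' → y ≡ y'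
  ρ-injective {x} {y} {y'} xy xy' eq
    with IsCyclicOn.cyclic (rotation-at rot x) (proj₁ rot x y xy) xy
       | IsCyclicOn.cyclic (rotation-at rot x) (proj₁ rot x y xy) xy'
  ... | k , back | m , forth = begin
    y                             ≡⟨ back ⟨
    iter g k (g y)                ≡⟨ cong (iter g k) eq ⟩
    iter g k (g y')               ≡⟨ iter-suc g k y' ⟨
    iter g (suc k) y'             ≡⟨ cong (iter g (suc k)) y'≡ ⟩
    iter g (suc k) (iter g (suc m) y) ≡⟨ iter-periodic-iter g {suc k} y-returns (suc m) ⟩
    iter g (suc m) y              ≡⟨ y'≡ ⟨
    y'                            ∎
    where
    open ≡-Reasoning
    g = ρ x
    y-returns : iter g (suc k) y ≡ y
    y-returns = trans (iter-suc g k y) back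
    y'≡ : y' ≡ iter g (suc m) y
    y'≡ = sym (trans (iter-suc g m y) forth)

  φ-closed : ∀ {d} → IsDart adj d → IsDart adj (φ ρ d)
  φ-closed {x , y} xy = proj₁ rot y x (trans (proj₁ simple y x) xy)

  φ-injective : ∀ {d e} → IsDart adj d → IsDart adj e → φ ρ d ≡ φ ρ e → d ≡ e
  φ-injective {x , y} {x' , y'} xy x'y' eq with cong proj₁ eq
  ... | refl = cong (_, y) (ρ-injective (trans (proj₁ simple y x) xy) (trans (proj₁ simple y x') x'y') (cong proj₂ eq))

  open Orbits (φ ρ) (IsDart adj) φ-closed φ-injective public
  open Finite _≟ᴰ_ encodeDart encodeDart-injective public

module AddEdge {n : ℕ} (adj : Adj n) (ρ : Rot n) (simple : SimpleGraph adj) (rot : IsRotation adj ρ)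
  {a b p q : Fin n} (a≢b : a ≢ b) (ab : adj a b ≡ false) (ap : adj a p ≡ true) (bq : adj b q ≡ true) where

  open Insertion (_≟_ {n})

  adj' : Adj n
  adj' = addEdge adj a b

  ρ' : Rot n
  ρ' x with x ≟ a | x ≟ b
  ... | yes _ | _     = insertAfter (ρ a) p b
  ... | no  _ | yes _ = insertAfter (ρ b) q a
  ... | no  _ | no  _ = ρ x

  private
    ba : adj b a ≡ false
    ba = trans (proj₁ simple b a) ab

    nonadj-≢ : ∀ {x y z} → adj x y ≡ true → adj x z ≡ false → y ≢ z
    nonadj-≢ xy xz refl = not-¬ xy xz

    p≢b : p ≢ b
    p≢b = nonadj-≢ ap ab

    q≢a : q ≢ a
    q≢a = nonadj-≢ bq ba

  ρ'-a : ∀ y → ρ' a y ≡ insertAfter (ρ a) p b y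
  ρ'-a y with a ≟ a
  ... | yes _   = refl
  ... | no  a≢a = ⊥-elim (a≢a refl)

  ρ'-b : ∀ y → ρ' b y ≡ insertAfter (ρ b) q a y
  ρ'-b y with b ≟ a | b ≟ b
  ... | yes b≡a | _       = ⊥-elim (a≢b (sym b≡a))
  ... | no  _   | yes _   = refl
  ... | no  _   | no  b≢b = ⊥-elim (b≢b refl)

  ρ'-away : ∀ {x} → x ≢ a → x ≢ b → ∀ y → ρ' x y ≡ ρ x y
  ρ'-away {x} x≢a x≢b y with x ≟ a | x ≟ b
  ... | yes x≡a | _       = ⊥-elim (x≢a x≡a)
  ... | no  _   | yes x≡b = ⊥-elim (x≢b x≡b)
  ... | no  _   | no  _   = refl

  adj'-a : ∀ y → adj' a y ≡ adj a y ∨ does (y ≟ b)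
  adj'-a y rewrite dec-true (a ≟ a) refl | dec-false (a ≟ b) a≢b = cong (adj a y ∨_) (∨-identityʳ _)

  adj'-b : ∀ y → adj' b y ≡ adj b y ∨ does (y ≟ a)
  adj'-b y rewrite dec-false (b ≟ a) (a≢b ∘ sym) | dec-true (b ≟ b) refl = refl

  adj'-away : ∀ {x} → x ≢ a → x ≢ b → ∀ y → adj' x y ≡ adj x y
  adj'-away {x} x≢a x≢b y rewrite dec-false (x ≟ a) x≢a | dec-false (x ≟ b) x≢b = ∨-identityʳ _

  adj'-⊇ : ∀ {x y} → adj x y ≡ true → adj' x y ≡ true
  adj'-⊇ xy = ∨-true⁺ˡ _ xy

  adj'-ab : adj' a b ≡ true
  adj'-ab = trans (adj'-a b) (∨-true⁺ʳ (adj a b) (dec-true (b ≟ b) refl))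

  adj'-ba : adj' b a ≡ true
  adj'-ba = trans (adj'-b a) (∨-true⁺ʳ (adj b a) (dec-true (a ≟ a) refl))

  private
    adj'-at⇔ : ∀ {x c} → (∀ y → adj' x y ≡ adj x y ∨ does (y ≟ c)) →
      ∀ y → (adj x y ≡ true ⊎ y ≡ c) ⇔ adj' x y ≡ true
    adj'-at⇔ {x} {c} adj'-x y = mk⇔
      (λ { (inj₁ xy)   → adj'-⊇ xy
         ; (inj₂ refl) → trans (adj'-x y) (∨-true⁺ʳ (adj x y) (dec-true (y ≟ y) refl)) })
      (λ x'y → map₂ (does≡true⇒ (y ≟ c)) (∨-true⁻ (adj x y) (trans (sym (adj'-x y)) x'y)))

    rotation-at' : ∀ x → Dec (x ≡ a) → Dec (x ≡ b) → IsCyclicOn (λ y → adj' x y ≡ true) (ρ' x)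
    rotation-at' x (yes refl) _ =
      IsCyclicOn-cong (sym ∘ ρ'-a) (IsCyclicOn-⇔ (adj'-at⇔ adj'-a)
        (insertAfter-isCyclicOn (rotation-at rot a) ap (λ ab' → not-¬ ab' ab)))
    rotation-at' x (no _) (yes refl) =
      IsCyclicOn-cong (sym ∘ ρ'-b) (IsCyclicOn-⇔ (adj'-at⇔ adj'-b)
        (insertAfter-isCyclicOn (rotation-at rot b) bq (λ ba' → not-¬ ba' ba)))
    rotation-at' x (no x≢a) (no x≢b) =
      IsCyclicOn-cong (sym ∘ ρ'-away x≢a x≢b)
        (IsCyclicOn-⇔ (λ y → mk⇔ (trans (adj'-away x≢a x≢b y)) (trans (sym (adj'-away x≢a x≢b y))))
          (rotation-at rot x))

  rotation' : IsRotation adj' ρ'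
  rotation' = rotation-from (λ x → rotation-at' x (x ≟ a) (x ≟ b))

  φ'-away : ∀ {d} → IsDart adj d → d ≢ (p , a) → d ≢ (q , b) → φ ρ' d ≡ φ ρ d
  φ'-away {x , y} xy ≢pa ≢qb = cong (y ,_) (by-cases (y ≟ a) (y ≟ b))
    where
    by-cases : Dec (y ≡ a) → Dec (y ≡ b) → ρ' y x ≡ ρ y x
    by-cases (yes refl) _ = trans (ρ'-a x)
      (insertAfter-other (ρ a) p b (≢pa ∘ cong (_, a)) (nonadj-≢ (trans (proj₁ simple a x) xy) ab))
    by-cases (no _) (yes refl) = trans (ρ'-b x)
      (insertAfter-other (ρ b) q a (≢qb ∘ cong (_, b)) (nonadj-≢ (trans (proj₁ simple b x) xy) ba))
    by-cases (no y≢a) (no y≢b) = ρ'-away y≢a y≢b x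

  φ'-pa : φ ρ' (p , a) ≡ (a , b)
  φ'-pa = cong (a ,_) (trans (ρ'-a p) (insertAfter-p (ρ a) p b))

  φ'-ab : φ ρ' (a , b) ≡ φ ρ (q , b)
  φ'-ab = cong (b ,_) (trans (ρ'-b a) (insertAfter-c (ρ b) q a (q≢a ∘ sym)))

  φ'-qb : φ ρ' (q , b) ≡ (b , a)
  φ'-qb = cong (b ,_) (trans (ρ'-b q) (insertAfter-p (ρ b) q a))

  φ'-ba : φ ρ' (b , a) ≡ φ ρ (p , a)
  φ'-ba = cong (a ,_) (trans (ρ'-a b) (insertAfter-c (ρ a) p b (p≢b ∘ sym)))

  isDart-adj' : ∀ d → isDart adj' d ≡ isDart adj d ∨ (does (d ≟ᴰ (a , b)) ∨ does (d ≟ᴰ (b , a)))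
  isDart-adj' (x , y) = cong₂ (λ u v → adj x y ∨ (u ∨ v)) (sym (does-≟ᴰ x y a b)) (sym (does-≟ᴰ x y b a))

  length-allDarts-addEdge : length (allDarts adj') ≡ 2 + length (allDarts adj)
  length-allDarts-addEdge = begin
    length (allDarts adj')                                ≡⟨ length-allDarts adj' ⟩
    count (isDart adj') allPairs                          ≡⟨ count-cong isDart-adj' allPairs ⟩
    count (λ d → isDart adj d ∨ new d) allPairs           ≡⟨ count-∨ (isDart adj) new disjoint allPairs ⟩
    count (isDart adj) allPairs + count new allPairs      ≡⟨ cong (_ +_) (count-≟ᴰ-pair (a≢b ∘ cong proj₁)) ⟩
    count (isDart adj) allPairs + 2                       ≡⟨ +-comm _ 2 ⟩
    2 + count (isDart adj) allPairs                       ≡⟨ cong (2 +_) (length-allDarts adj) ⟨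
    2 + length (allDarts adj)                             ∎
    where
    open ≡-Reasoning
    new : Dart n → Bool
    new d = does (d ≟ᴰ (a , b)) ∨ does (d ≟ᴰ (b , a))
    disjoint : ∀ d → isDart adj d ∧ new d ≡ false
    disjoint (x , y) with adj x y in xy
    ... | false = refl
    ... | true with (x , y) ≟ᴰ (a , b) | (x , y) ≟ᴰ (b , a)
    ...   | yes refl | _        = ⊥-elim (not-¬ xy ab)
    ...   | no  _    | yes refl = ⊥-elim (not-¬ xy ba)
    ...   | no  _    | no  _    = refl

-- The face of α is the cycle of darts c 0, …, c P', where c j = (q , b) and c P' = (p , a).
-- The chord ab splits it into face A: (a , b), c (suc j), …, c P' and face B: (b , a), c 0, …, c j.
module SplitFace {n : ℕ} (adj : Adj n) (ρ : Rot n) (simple : SimpleGraph adj) (rot : IsRotation adj ρ)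
  {α : Dart n} (α-dart : IsDart adj α) (j m : ℕ) (P≤ : suc (suc (j + m)) ≤ n * n)
  (cycle : RotationSystem.Cycle adj ρ simple rot α (suc (suc (j + m))))
  (nonadj : adj (proj₁ α) (proj₁ (iter (φ ρ) (suc j) α)) ≡ false)
  (a≢b : proj₁ α ≢ proj₁ (iter (φ ρ) (suc j) α)) where

  open RotationSystem adj ρ simple rot

  P' P : ℕ
  P' = suc (j + m)
  P  = suc P'

  c : ℕ → Dart n
  c k = iter (φ ρ) k α

  a b p q : Fin n
  a = proj₁ α
  b = proj₁ (c (suc j))
  p = proj₁ (c P')
  q = proj₁ (c j)

  c-dart : ∀ k → IsDart adj (c k)
  c-dart k = iter-closed k α-dart

  c-injective : ∀ {k l} → k < P → l < P → c k ≡ c l → k ≡ l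
  c-injective = cycle-injective α-dart cycle

  closes : c P ≡ α
  closes = Cycle.closes cycle

  cP'≡pa : c P' ≡ (p , a)
  cP'≡pa = cong (p ,_) (cong proj₁ closes)

  private
    ap : adj a p ≡ true
    ap = trans (proj₁ simple a p) (subst (λ x → adj p x ≡ true) (cong proj₁ closes) (c-dart P'))

    bq : adj b q ≡ true
    bq = trans (proj₁ simple b q) (c-dart j)

  open AddEdge adj ρ simple rot a≢b nonadj ap bq public

  φ' : Dart n → Dart n
  φ' = φ ρ'

  oA oB : Dart n
  oA = (a , b)
  oB = (b , a)

  φ'-face : ∀ t → t < P' → t ≢ j → φ' (c t) ≡ c (suc t)
  φ'-face t t<P' t≢j = φ'-away (c-dart t)
    (λ eq → <⇒≢ t<P' (c-injective (m≤n⇒m≤1+n t<P') ≤-refl (trans eq (sym cP'≡pa))))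
    (λ eq → t≢j (c-injective (m≤n⇒m≤1+n t<P') (s≤s (m≤n⇒m≤1+n (m≤m+n j m))) eq))

  A-path : ∀ k → k ≤ m → iter φ' k (c (suc j)) ≡ c (suc j + k)
  A-path zero    _   = cong c (sym (+-identityʳ (suc j)))
  A-path (suc k) k<m = begin
    φ' (iter φ' k (c (suc j)))   ≡⟨ cong φ' (A-path k (<⇒≤ k<m)) ⟩
    φ' (c (suc j + k))           ≡⟨ φ'-face (suc j + k) (s≤s (+-monoʳ-< j k<m)) suc-j+k≢j ⟩
    c (suc (suc j + k))          ≡⟨ cong c (sym (+-suc (suc j) k)) ⟩
    c (suc j + suc k)            ∎
    where
    open ≡-Reasoning
    suc-j+k≢j : suc j + k ≢ j
    suc-j+k≢j eq = 1+n≰n (subst (suc j ≤_) eq (m≤m+n (suc j) k))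

  B-path : ∀ k → k ≤ j → iter φ' k α ≡ c k
  B-path zero    _   = refl
  B-path (suc k) k<j = trans (cong φ' (B-path k (<⇒≤ k<j)))
    (φ'-face k (≤-trans k<j (m≤n⇒m≤1+n (m≤m+n j m))) (<⇒≢ k<j))

  A-orbit : ∀ k → k ≤ m → iter φ' (suc k) oA ≡ c (suc j + k)
  A-orbit k k≤m = trans (iter-suc φ' k oA) (trans (cong (iter φ' k) φ'-ab) (A-path k k≤m))

  B-orbit : ∀ k → k ≤ j → iter φ' (suc k) oB ≡ c k
  B-orbit k k≤j = trans (iter-suc φ' k oB) (trans (cong (iter φ' k) (trans φ'-ba (cong (φ ρ) (sym cP'≡pa)))) 
    (trans (cong (iter φ' k) closes) (B-path k k≤j)))

  A-closes : iter φ' (suc (suc m)) oA ≡ oA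
  A-closes = trans (cong φ' (A-orbit m ≤-refl)) (trans (cong φ' cP'≡pa) φ'-pa)

  B-closes : iter φ' (suc (suc j)) oB ≡ oB
  B-closes = trans (cong φ' (B-orbit j ≤-refl)) φ'-qb

  rA rB : ℕ
  rA = suc (suc m)
  rB = suc (suc j)

  module OldFace = OrbitMin (φ ρ) α P P≤ closes
  module FaceA = OrbitMin φ' oA rA (≤-trans (s≤s (s≤s (m≤n+m m j))) P≤) A-closes
  module FaceB = OrbitMin φ' oB rB (≤-trans (s≤s (s≤s (m≤m+n j m))) P≤) B-closes

  A-elements : ∀ i → i < rA → iter φ' i oA ≡ oA ⊎ ∃ λ k → k ≤ m × iter φ' i oA ≡ c (suc j + k)
  A-elements zero    _       = inj₁ refl
  A-elements (suc k) (s≤s k<) = inj₂ (k , ≤-pred k< , A-orbit k (≤-pred k<))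

  B-elements : ∀ i → i < rB → iter φ' i oB ≡ oB ⊎ ∃ λ k → k ≤ j × iter φ' i oB ≡ c k
  B-elements zero    _       = inj₁ refl
  B-elements (suc k) (s≤s k<) = inj₂ (k , ≤-pred k< , B-orbit k (≤-pred k<))

  onFace : Dart n → Bool
  onFace d = does (anyUpTo? (λ i → c i ≟ᴰ d) P)

  touched : Dart n → Bool
  touched d = onFace d ∨ (does (d ≟ᴰ oA) ∨ does (d ≟ᴰ oB))

  touched-cases : ∀ {d} → touched d ≡ true → (∃ λ i → i < P × c i ≡ d) ⊎ (d ≡ oA ⊎ d ≡ oB)
  touched-cases {d} t with ∨-true⁻ _ t
  ... | inj₁ on-face = inj₁ (does≡true⇒ (anyUpTo? (λ i → c i ≟ᴰ d) P) on-face)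
  ... | inj₂ new with ∨-true⁻ _ new
  ...   | inj₁ isA = inj₂ (inj₁ (does≡true⇒ (d ≟ᴰ oA) isA))
  ...   | inj₂ isB = inj₂ (inj₂ (does≡true⇒ (d ≟ᴰ oB) isB))

  face-touched : ∀ {i} → i < P → touched (c i) ≡ true
  face-touched {i} i<P = ∨-true⁺ˡ _ (dec-true (anyUpTo? (λ k → c k ≟ᴰ c i) P) (i , i<P , refl))

  oA-touched : touched oA ≡ true
  oA-touched = ∨-true⁺ʳ (onFace oA) (∨-true⁺ˡ _ (dec-true (oA ≟ᴰ oA) refl))

  oB-touched : touched oB ≡ true
  oB-touched = ∨-true⁺ʳ (onFace oB) (∨-true⁺ʳ (does (oB ≟ᴰ oA)) (dec-true (oB ≟ᴰ oB) refl))

  touched-dart' : ∀ {d} → touched d ≡ true → IsDart adj' d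
  touched-dart' t with touched-cases t
  ... | inj₁ (i , _ , refl)  = adj'-⊇ (c-dart i)
  ... | inj₂ (inj₁ refl)     = adj'-ab
  ... | inj₂ (inj₂ refl)     = adj'-ba

  touched-on-A∪B : ∀ {d} → touched d ≡ true → (∃ λ i → iter φ' i oA ≡ d) ⊎ (∃ λ i → iter φ' i oB ≡ d)
  touched-on-A∪B t with touched-cases t
  ... | inj₂ (inj₁ refl) = inj₁ (0 , refl)
  ... | inj₂ (inj₂ refl) = inj₂ (0 , refl)
  ... | inj₁ (i , i<P , refl) with i ≤? j
  ...   | yes i≤j = inj₂ (suc i , B-orbit i i≤j)
  ...   | no  i≰j = inj₁ (suc (i ∸ suc j) , trans (A-orbit (i ∸ suc j) k≤m) (cong c (m+[n∸m]≡n (≰⇒> i≰j))))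
    where k≤m : i ∸ suc j ≤ m
          k≤m = subst (i ∸ suc j ≤_) (m+n∸m≡n (suc j) m) (∸-monoˡ-≤ (suc j) (≤-pred i<P))

  A-touched : ∀ {i} → i < rA → touched (iter φ' i oA) ≡ true
  A-touched {i} i<rA with A-elements i i<rA
  ... | inj₁ eq            = subst (λ d → touched d ≡ true) (sym eq) oA-touched
  ... | inj₂ (k , k≤m , eq) =
    subst (λ d → touched d ≡ true) (sym eq) (face-touched (s≤s (s≤s (+-monoʳ-≤ j k≤m))))

  B-touched : ∀ {i} → i < rB → touched (iter φ' i oB) ≡ true
  B-touched {i} i<rB with B-elements i i<rB
  ... | inj₁ eq            = subst (λ d → touched d ≡ true) (sym eq) oB-touched
  ... | inj₂ (k , k≤j , eq) =
    subst (λ d → touched d ≡ true) (sym eq) (face-touched (s≤s (≤-trans k≤j (m≤n⇒m≤1+n (m≤m+n j m)))))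

  oA-not-dart : ¬ IsDart adj oA
  oA-not-dart ab = not-¬ ab nonadj

  oB-not-dart : ¬ IsDart adj oB
  oB-not-dart ba = not-¬ ba (trans (proj₁ simple b a) nonadj)

  A∩B-disjoint : ∀ {i i'} → i < rA → i' < rB → iter φ' i oA ≢ iter φ' i' oB
  A∩B-disjoint {i} {i'} i<rA i'<rB eq with A-elements i i<rA | B-elements i' i'<rB
  ... | inj₁ eA | inj₁ eB = a≢b (cong proj₁ (trans (sym eA) (trans eq eB)))
  ... | inj₁ eA | inj₂ (k , _ , eB) = oA-not-dart (subst (IsDart adj) (trans (sym eB) (trans (sym eq) eA)) (c-dart k))
  ... | inj₂ (k , _ , eA) | inj₁ eB = oB-not-dart (subst (IsDart adj) (trans (sym eA) (trans eq eB)) (c-dart (suc j + k)))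
  ... | inj₂ (k , k≤m , eA) | inj₂ (k' , k'≤j , eB) =
    <⇒≢ (s≤s (≤-trans k'≤j (m≤m+n j k)))
        (sym (c-injective (s≤s (s≤s (+-monoʳ-≤ j k≤m))) (s≤s (≤-trans k'≤j (m≤n⇒m≤1+n (m≤m+n j m))))
                          (trans (sym eA) (trans eq eB))))

  isFaceRep isFaceRep' : Dart n → Bool
  isFaceRep  d = isDart adj d ∧ isOrbitMin (φ ρ) d
  isFaceRep' d = isDart adj' d ∧ isOrbitMin φ' d

  touched-reps : ∀ d → isFaceRep d ∧ touched d ≡ does (d ≟ᴰ OldFace.orbitMin)
  touched-reps d = ⇔→≡ (mk⇔ to from)
    where
    to : isFaceRep d ∧ touched d ≡ true → does (d ≟ᴰ OldFace.orbitMin) ≡ true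
    to rep∧t with ∧-true⁻ (isFaceRep d) rep∧t
    ... | rep , t with ∧-true⁻ (isDart adj d) rep | touched-cases t
    ...   | _    , min | inj₁ (i , _ , eq) = dec-true (d ≟ᴰ OldFace.orbitMin)
            (trans (sym eq) (OldFace.isOrbitMin⇒≡orbitMin i (subst (λ e → isOrbitMin (φ ρ) e ≡ true) (sym eq) min)))
    ...   | dart , _   | inj₂ (inj₁ eq)    = ⊥-elim (oA-not-dart (subst (IsDart adj) eq dart))
    ...   | dart , _   | inj₂ (inj₂ eq)    = ⊥-elim (oB-not-dart (subst (IsDart adj) eq dart))
    from : does (d ≟ᴰ OldFace.orbitMin) ≡ true → isFaceRep d ∧ touched d ≡ true
    from is-min with does≡true⇒ (d ≟ᴰ OldFace.orbitMin) is-min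
    ... | refl = ∧-true⁺ (∧-true⁺ (c-dart i₀) OldFace.isOrbitMin-orbitMin) (face-touched i₀<P)
      where i₀ : ℕ
            i₀ = proj₁ OldFace.least
            i₀<P : i₀ < P
            i₀<P = proj₁ (proj₂ OldFace.least)

  touched-reps' : ∀ d → isFaceRep' d ∧ touched d ≡ does (d ≟ᴰ FaceA.orbitMin) ∨ does (d ≟ᴰ FaceB.orbitMin)
  touched-reps' d = ⇔→≡ (mk⇔ to from)
    where
    to : isFaceRep' d ∧ touched d ≡ true → does (d ≟ᴰ FaceA.orbitMin) ∨ does (d ≟ᴰ FaceB.orbitMin) ≡ true
    to rep∧t = [ on-A , on-B ] (touched-on-A∪B (proj₂ (∧-true⁻ (isFaceRep' d) rep∧t)))
      where
      min : isOrbitMin φ' d ≡ true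
      min = proj₂ (∧-true⁻ (isDart adj' d) (proj₁ (∧-true⁻ (isFaceRep' d) rep∧t)))
      min-at : ∀ {e} → e ≡ d → isOrbitMin φ' e ≡ true
      min-at eq = subst (λ e → isOrbitMin φ' e ≡ true) (sym eq) min
      on-A : (∃ λ i → iter φ' i oA ≡ d) → does (d ≟ᴰ FaceA.orbitMin) ∨ does (d ≟ᴰ FaceB.orbitMin) ≡ true
      on-A (i , eq) = ∨-true⁺ˡ (does (d ≟ᴰ FaceB.orbitMin))
        (dec-true (d ≟ᴰ FaceA.orbitMin) (trans (sym eq) (FaceA.isOrbitMin⇒≡orbitMin i (min-at eq))))
      on-B : (∃ λ i → iter φ' i oB ≡ d) → does (d ≟ᴰ FaceA.orbitMin) ∨ does (d ≟ᴰ FaceB.orbitMin) ≡ true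
      on-B (i , eq) = ∨-true⁺ʳ (does (d ≟ᴰ FaceA.orbitMin))
        (dec-true (d ≟ᴰ FaceB.orbitMin) (trans (sym eq) (FaceB.isOrbitMin⇒≡orbitMin i (min-at eq))))
    IsTouchedRep : Dart n → Set
    IsTouchedRep e = isFaceRep' e ∧ touched e ≡ true
    touched-rep : ∀ {e} → touched e ≡ true → isOrbitMin φ' e ≡ true → IsTouchedRep e
    touched-rep t min = ∧-true⁺ (∧-true⁺ (touched-dart' t) min) t
    A-rep : IsTouchedRep FaceA.orbitMin
    A-rep = touched-rep {FaceA.orbitMin} (A-touched (proj₁ (proj₂ FaceA.least))) FaceA.isOrbitMin-orbitMin
    B-rep : IsTouchedRep FaceB.orbitMin
    B-rep = touched-rep {FaceB.orbitMin} (B-touched (proj₁ (proj₂ FaceB.least))) FaceB.isOrbitMin-orbitMin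
    from : does (d ≟ᴰ FaceA.orbitMin) ∨ does (d ≟ᴰ FaceB.orbitMin) ≡ true → IsTouchedRep d
    from is-min =
      [ (λ isA → subst IsTouchedRep (sym (does≡true⇒ (d ≟ᴰ FaceA.orbitMin) isA)) A-rep)
      , (λ isB → subst IsTouchedRep (sym (does≡true⇒ (d ≟ᴰ FaceB.orbitMin) isB)) B-rep)
      ] (∨-true⁻ (does (d ≟ᴰ FaceA.orbitMin)) is-min)

  untouched-reps : ∀ d → touched d ≡ false → isFaceRep' d ≡ isFaceRep d
  untouched-reps d untouched = trans (cong (_∧ isOrbitMin φ' d) same-dart)
                                     (∧-cong-true (isDart adj d) (isOrbitMin-cong ∘ same-orbit))
    where
    ≢oA : d ≢ oA
    ≢oA refl = not-¬ oA-touched untouched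
    ≢oB : d ≢ oB
    ≢oB refl = not-¬ oB-touched untouched
    off-face : ∀ {i} → i < P → c i ≢ d
    off-face i<P refl = not-¬ (face-touched i<P) untouched
    same-dart : isDart adj' d ≡ isDart adj d
    same-dart rewrite isDart-adj' d | dec-false (d ≟ᴰ oA) ≢oA | dec-false (d ≟ᴰ oB) ≢oB = ∨-identityʳ _
    module _ (dart : IsDart adj d) where
      orbit-off-face : ∀ k {i} → i < P → iter (φ ρ) k d ≢ c i
      orbit-off-face zero    i<P eq = off-face i<P (sym eq)
      orbit-off-face (suc k) {zero}  _         eq =
        orbit-off-face k ≤-refl (φ-injective (iter-closed k dart) (c-dart P') (trans eq (sym closes)))
      orbit-off-face (suc k) {suc i} (s≤s i<P') eq =
        orbit-off-face k (m≤n⇒m≤1+n i<P') (φ-injective (iter-closed k dart) (c-dart i) eq)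
      same-orbit : ∀ k → iter φ' k d ≡ iter (φ ρ) k d
      same-orbit zero    = refl
      same-orbit (suc k) = trans (cong φ' (same-orbit k)) (φ'-away (iter-closed k dart)
        (λ eq → orbit-off-face k ≤-refl (trans eq (sym cP'≡pa)))
        (orbit-off-face k (s≤s (m≤n⇒m≤1+n (m≤m+n j m)))))

  numFaces-split : numFaces adj' ρ' ≡ suc (numFaces adj ρ)
  numFaces-split = begin
    numFaces adj' ρ'
      ≡⟨ numFaces≡count adj' ρ' ⟩
    count isFaceRep' allPairs
      ≡⟨ count-split isFaceRep' touched allPairs ⟩
    count (λ d → isFaceRep' d ∧ not (touched d)) allPairs + count (λ d → isFaceRep' d ∧ touched d) allPairs
      ≡⟨ cong₂ _+_ (count-cong same-untouched allPairs) new-touched ⟩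
    X + 2
      ≡⟨ +-suc X 1 ⟩
    suc (X + 1)
      ≡⟨ cong (λ k → suc (X + k)) old-touched ⟨
    suc (X + count (λ d → isFaceRep d ∧ touched d) allPairs)
      ≡⟨ cong suc (count-split isFaceRep touched allPairs) ⟨
    suc (count isFaceRep allPairs)
      ≡⟨ cong suc (numFaces≡count adj ρ) ⟨
    suc (numFaces adj ρ)
      ∎
    where
    open ≡-Reasoning
    X : ℕ
    X = count (λ d → isFaceRep d ∧ not (touched d)) allPairs
    old-touched : count (λ d → isFaceRep d ∧ touched d) allPairs ≡ 1
    old-touched = trans (count-cong touched-reps allPairs) (count-≟ᴰ OldFace.orbitMin)
    new-touched : count (λ d → isFaceRep' d ∧ touched d) allPairs ≡ 2
    new-touched = trans (count-cong touched-reps' allPairs)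
      (count-≟ᴰ-pair (A∩B-disjoint (proj₁ (proj₂ FaceA.least)) (proj₁ (proj₂ FaceB.least))))
    same-untouched : ∀ d → isFaceRep' d ∧ not (touched d) ≡ isFaceRep d ∧ not (touched d)
    same-untouched d with touched d in t
    ... | true  = trans (∧-zeroʳ _) (sym (∧-zeroʳ _))
    ... | false = cong (_∧ true) (untouched-reps d t)

  chord-planar : Connected adj → Genus0 adj ρ → ConnectedPlanar adj'
  chord-planar connected genus0 =
    (λ u v → let (k , w) = connected u v in k , Walk-mono adj'-⊇ w) ,
    ρ' , rotation' , Genus0-step numFaces-split length-allDarts-addEdge genus0

module _ {n : ℕ} {adj : Adj n} {ρ : Rot n} (maximal : MaximalPlanar adj) (embedding : PlaneEmbedding adj ρ) where

  private
    simple : SimpleGraph adj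
    simple = proj₁ maximal
    connected : Connected adj
    connected = proj₁ (proj₁ (proj₂ maximal))
    open RotationSystem adj ρ simple (proj₁ embedding)

  face-adjacent : ∀ {α P} → IsDart adj α → P ≤ n * n → Cycle α P → ∀ {J} → J < P →
    proj₁ α ≢ proj₁ (iter (φ ρ) J α) → adj (proj₁ α) (proj₁ (iter (φ ρ) J α)) ≡ true
  face-adjacent α-dart P≤ cycle {zero}  _   a≢b = ⊥-elim (a≢b refl)
  face-adjacent {α} {P} α-dart P≤ cycle {suc j} J<P a≢b with adj (proj₁ α) (proj₁ (iter (φ ρ) (suc j) α)) in ab
  ... | true  = refl
  ... | false = ⊥-elim (proj₂ (proj₂ maximal) _ _ a≢b ab
                  (SplitFace.chord-planar adj ρ simple (proj₁ embedding) α-dart j m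
                    (subst (_≤ n * n) P≡ P≤) (subst (Cycle α) P≡ cycle) ab a≢b connected (proj₂ embedding)))
    where m : ℕ
          m = P ∸ suc (suc j)
          P≡ : P ≡ suc (suc (j + m))
          P≡ = sym (m+[n∸m]≡n J<P)

  face-clique : ∀ {d₀} → IsDart adj d₀ →
    ∀ {u w} → FaceVertices ρ d₀ u → FaceVertices ρ d₀ w → u ≢ w → adj u w ≡ true
  face-clique {d₀} d₀-dart (i , refl) (i' , refl) u≢w
    with cycle-through d₀-dart | cycle-through (iter-closed i d₀-dart)
  ... | P₀ , _ , cycle₀ | P , P≤ , cycle = subst (λ d → adj (proj₁ (iter (φ ρ) i d₀)) (proj₁ d) ≡ true) reached
      (face-adjacent (iter-closed i d₀-dart) P≤ cycle (m%n<n K P) (λ eq → u≢w (trans eq (cong proj₁ reached))))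
    where
    instance
      P₀-nonZero : NonZero P₀
      P₀-nonZero = >-nonZero (Cycle.nonempty cycle₀)
      P-nonZero : NonZero P
      P-nonZero = >-nonZero (Cycle.nonempty cycle)
    K : ℕ
    K = i' + i * P₀ ∸ i
    reached : iter (φ ρ) (K % P) (iter (φ ρ) i d₀) ≡ iter (φ ρ) i' d₀
    reached = trans (sym (iter-periodic-% (φ ρ) {P} (Cycle.closes cycle) K))
                    (iter-periodic-reach (φ ρ) {P₀} (Cycle.closes cycle₀) i i')

Walk-snoc : ∀ {n} {adj : Adj n} {u v w k} → Walk adj u v k → adj v w ≡ true → Walk adj u w (suc k)
Walk-snoc nil        vw = cons vw nil
Walk-snoc (cons e w) vw = cons e (Walk-snoc w vw)

module _ {n : ℕ} {adj : Adj n} {F : Fin n → Set}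
  (clique : ∀ {s s'} → F s → F s' → s ≢ s' → adj s s' ≡ true) where

  dist-to-clique : ∀ {v dv s k} → IsDistSet adj v F dv → F s → IsDist adj v s k → k ≤ dv + 1
  dist-to-clique {v} {dv} {s} {k} ((s₀ , Fs₀ , walk₀ , _) , _) Fs (_ , shortest) with s₀ ≟ s
  ... | yes refl = ≤-trans (shortest dv walk₀) (m≤m+n dv 1)
  ... | no  s₀≢s = subst (k ≤_) (+-comm 1 dv) (shortest (suc dv) (Walk-snoc walk₀ (clique Fs₀ Fs s₀≢s)))

  qcc-dist-bound : ∀ {u v du dv} → InQcc adj F v → IsDistSet adj u F du → IsDistSet adj v F dv → du ≤ dv + 1
  qcc-dist-bound {u} qcc-v (_ , u-nearest) dist-v with qcc-v u
  ... | s , Fs , k , k' , dist-vs , dist-us , k'≤k =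
    ≤-trans (u-nearest s k' Fs dist-us) (≤-trans k'≤k (dist-to-clique dist-v Fs dist-vs))

lemma10 : ∀ (n : ℕ) (adj : Adj n) (ρ : Rot n) →
    MaximalPlanar adj → PlaneEmbedding adj ρ →
    ∀ (x₀ y₀ : Fin n) → adj x₀ y₀ ≡ true →
    ∀ (u v : Fin n) →
    InQcc adj (FaceVertices ρ (x₀ , y₀)) u →
    InQcc adj (FaceVertices ρ (x₀ , y₀)) v →
    ∀ (du dv : ℕ) →
    IsDistSet adj u (FaceVertices ρ (x₀ , y₀)) du →
    IsDistSet adj v (FaceVertices ρ (x₀ , y₀)) dv →
    (du ≤ dv + 1) × (dv ≤ du + 1)
lemma10 n adj ρ maximal embedding x₀ y₀ x₀y₀ u v qcc-u qcc-v du dv dist-u dist-v =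
  qcc-dist-bound clique qcc-v dist-u dist-v , qcc-dist-bound clique qcc-u dist-v dist-u
  where
  clique : ∀ {s s'} → FaceVertices ρ (x₀ , y₀) s → FaceVertices ρ (x₀ , y₀) s' → s ≢ s' → adj s s' ≡ true
  clique = face-clique maximal embedding x₀y₀
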